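{- Let $G$ be a cubic graph. If $G$ has a cyclic core, then $G$ has an even 3-cycle cover of length smaller than $\frac{14}{9}|E(G)|$.
   Context: Graphs are finite, may have parallel edges, but no loops. A 1-factor is a spanning 1-regular subgraph, identified with its edge set. For $X\subseteq E(G)$, $G[X]$ is the graph with edge set $X$ and vertex set all endpoints of edges of $X$. For three pairwise different 1-factors $M_1,M_2,M_3$ of a cubic graph $G$, let $\mathcal{M} = \bigcup_{i\neq j}(M_i\cap M_j)$ and $\mathcal{U} = E(G) - (M_1\cup M_2\cup M_3)$; $G[\mathcal{M}\cup\mathcal{U}]$ is the core of $G$ with respect to $M_1,M_2,M_3$. A core is cyclic if it is a cycle, i.e. all its vertices have even degree (equivalently it is 2-regular); $G$ has a cyclic core iff it has three 1-factors with $M_1\cap M_2\cap M_3=\emptyset$. A cycle is a subgraph all of whose vertices have even degree; it is even if all its circuits have even length. A 3-cycle cover is a set of at most 3 cycles covering every edge at least once; it is even if all its cycles are even; its length is $\sum_C |E(C)|$. -}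

module Defs where

open import Data.Nat as ℕ using (ℕ; zero; suc; _+_; _*_; _<_; _≤_)
open import Data.Nat.Divisibility using (_∣_)
open import Data.Fin as Fin using (Fin; toℕ; lower₁)
open import Data.Fin.Subset using (Subset; _∈_; _∪_; _∩_; ∁; ∣_∣; ⊤)
open import Data.Vec using (tabulate)
open import Data.Bool using (Bool; _∨_)
open import Data.Product using (_×_; _,_; proj₁; proj₂; Σ; ∃)
open import Data.Sum using (_⊎_)
open import Function.Definitions using (Injective)
open import Relation.Nullary using (¬_; yes; no)
open import Relation.Nullary.Decidable using (⌊_⌋)
open import Relation.Binary.PropositionalEquality using (_≡_; _≢_)

-- A finite multigraph: vertices Fin n, edges Fin m, each edge has two endpoints.
-- Parallel edges are allowed; loops are excluded by the field noLoops.
record Graph : Set where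
  field
    n       : ℕ
    m       : ℕ
    ends    : Fin m → Fin n × Fin n
    noLoops : ∀ e → proj₁ (ends e) ≢ proj₂ (ends e)

open Graph public

EdgeSet : Graph → Set
EdgeSet G = Subset (m G)

incident : (G : Graph) → Fin (n G) → Fin (m G) → Bool
incident G v e = ⌊ v Fin.≟ proj₁ (ends G e) ⌋ ∨ ⌊ v Fin.≟ proj₂ (ends G e) ⌋

star : (G : Graph) → Fin (n G) → EdgeSet G
star G v = tabulate (incident G v)

-- degree of v in the subgraph with edge set X (no loops, so each edge counts once)
deg : (G : Graph) → EdgeSet G → Fin (n G) → ℕ
deg G X v = ∣ X ∩ star G v ∣

Cubic : Graph → Set
Cubic G = ∀ v → deg G ⊤ v ≡ 3

IsOneFactor : (G : Graph) → EdgeSet G → Set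
IsOneFactor G M = ∀ v → deg G M v ≡ 1

IsCycle : (G : Graph) → EdgeSet G → Set
IsCycle G X = ∀ v → 2 ∣ deg G X v

next : ∀ {k} → Fin (suc k) → Fin (suc k)
next {k} i with k ℕ.≟ toℕ i
... | yes _ = Fin.zero
... | no ne = Fin.suc (lower₁ i ne)

Joins : (G : Graph) → Fin (m G) → Fin (n G) → Fin (n G) → Set
Joins G e u w = ends G e ≡ (u , w) ⊎ ends G e ≡ (w , u)

-- a circuit of length (suc k) in X: distinct vertices vs 0..k and distinct
-- edges es 0..k of X, edge es i joining vs i and vs (i+1 mod (k+1)); length ≥ 2
record Circuit (G : Graph) (X : EdgeSet G) (k : ℕ) : Set where
  field
    len≥2  : 1 ≤ k
    vs     : Fin (suc k) → Fin (n G)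
    es     : Fin (suc k) → Fin (m G)
    vsInj  : Injective _≡_ _≡_ vs
    esInj  : Injective _≡_ _≡_ es
    esIn   : ∀ i → es i ∈ X
    esJoin : ∀ i → Joins G (es i) (vs i) (vs (next i))

IsEvenCycle : (G : Graph) → EdgeSet G → Set
IsEvenCycle G X = IsCycle G X × (∀ k → Circuit G X k → 2 ∣ suc k)

coreEdges : (G : Graph) → EdgeSet G → EdgeSet G → EdgeSet G → EdgeSet G
coreEdges G M₁ M₂ M₃ =
  ((M₁ ∩ M₂) ∪ (M₁ ∩ M₃) ∪ (M₂ ∩ M₃)) ∪ ∁ (M₁ ∪ M₂ ∪ M₃)

HasCyclicCore : Graph → Set
HasCyclicCore G =
  Σ (EdgeSet G) λ M₁ → Σ (EdgeSet G) λ M₂ → Σ (EdgeSet G) λ M₃ →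
    IsOneFactor G M₁ × IsOneFactor G M₂ × IsOneFactor G M₃ ×
    M₁ ≢ M₂ × M₁ ≢ M₃ × M₂ ≢ M₃ ×
    IsCycle G (coreEdges G M₁ M₂ M₃)

-- an even 3-cycle cover of length smaller than (14/9)|E(G)|
-- (at most three cycles: unused slots may be the empty cycle, length 0)
HasShortEven3CC : Graph → Set
HasShortEven3CC G =
  Σ (EdgeSet G) λ C₁ → Σ (EdgeSet G) λ C₂ → Σ (EdgeSet G) λ C₃ →
    IsEvenCycle G C₁ × IsEvenCycle G C₂ × IsEvenCycle G C₃ ×
    (∀ e → e ∈ C₁ ∪ C₂ ∪ C₃) ×
    9 * (∣ C₁ ∣ + ∣ C₂ ∣ + ∣ C₃ ∣) < 14 * m G

-- Sort the edges by how many of the three 1-factors contain them: 𝓢 (exactly one), 𝓜 (at least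
-- two), 𝓤 (none), 𝓣 (all three). At a vertex the factors meet with total multiplicity 3 and the
-- core 𝓜 ∪ 𝓤 has even degree, which leaves two local pictures: three 𝓢-edges, or one edge from
-- each of 𝓢, 𝓜, 𝓤. So 𝓜 and 𝓤 are matchings with |𝓜| = |𝓤|; since a subgraph covered by two
-- matchings has only even circuits, the core and every Mᵢ Δ Mⱼ are even cycles. If every vertex
-- shows the second picture, 𝓢 ∪ 𝓜 is an even cycle too and {core, 𝓢 ∪ 𝓜} is short enough.
-- Otherwise |𝓜| < |𝓢|, and the three covers {Mᵢ Δ Mⱼ, Mᵢ Δ Mₖ, core}, which together use every
-- Mᵢ Δ Mⱼ twice and the core three times, have average length below 14|E|/9.

module Submission where

open import Defs

open import Data.Bool using (Bool; true; false; _∧_; _∨_; not; _xor_)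
open import Data.Bool.Properties as Boolₚ using (¬-not; not-¬; not-involutive; ∨-zeroʳ)
open import Data.Empty using (⊥; ⊥-elim)
open import Data.Fin as Fin using (Fin; zero; suc; toℕ; fromℕ<)
import Data.Fin.Properties as Finₚ
open import Data.Fin.Subset using (Subset; _∈_; _∉_; _⊆_; _∪_; _∩_; ∁; ∣_∣; ⊤)
  renaming (⊥ to ∅)
open import Data.Fin.Subset.Properties
  using (x∈p⇒∣p-x∣<∣p∣; x∈p∧x≢y⇒x∈p-y; p⊆q⇒∣p∣≤∣q∣; x∈p∩q⁺; x∈p∩q⁻; x∈p∪q⁺; x∈p∪q⁻;
         _∈?_; x∉p⇒x∈∁p; x∈∁p⇒x∉p; x∈p⇒x∉∁p; p∩q⊆p; ∩-zeroˡ; ∣⊥∣≡0; ∣⊤∣≡n; ∉⊥)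
open import Data.Nat as ℕ using (ℕ; zero; suc; _+_; _*_; _≤_; _<_; z≤n; s≤s)
open import Data.Nat.Properties
open import Data.Nat.Divisibility using (_∣_; divides; ∣1⇒≡1; ∣m+n∣m⇒∣n; ∣-refl; _∣0)
open import Data.Product using (_×_; _,_; proj₁; proj₂; ∃)
open import Data.Sum using (_⊎_; inj₁; inj₂)
open import Data.List using ([]; _∷_)
open import Data.Vec as Vec using (lookup; tabulate; zipWith)
open import Data.Vec.Properties
  using (lookup-zipWith; lookup-map; lookup∘tabulate; lookup-replicate; []=⇒lookup; lookup⇒[]=;
         tabulate∘lookup; tabulate-cong)
open import Data.Vec.Functional using (Vector)
open import Function using (_∘_; id)
open import Relation.Binary.PropositionalEquality
open import Relation.Nullary using (yes; no; contradiction)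
open import Relation.Nullary.Decidable using (⌊_⌋)

open import Data.Nat.Tactic.RingSolver using (solve)
open import Algebra.Properties.Semiring.Sum +-*-semiring
  using (sum; sum-syntax; sum-cong-≗; ∑-distrib-+; ∑-comm; *-distribˡ-sum; sum-replicate-zero)

⟦_⟧ : Bool → ℕ
⟦ true ⟧  = 1
⟦ false ⟧ = 0

⟦∧⟧ : ∀ a b → ⟦ a ∧ b ⟧ ≡ ⟦ a ⟧ * ⟦ b ⟧
⟦∧⟧ true  true  = refl
⟦∧⟧ true  false = refl
⟦∧⟧ false _     = refl

sum-mono-≤ : ∀ {k} {f g : Vector ℕ k} → (∀ i → f i ≤ g i) → sum f ≤ sum g
sum-mono-≤ {zero}  f≤g = z≤n
sum-mono-≤ {suc k} f≤g = +-mono-≤ (f≤g zero) (sum-mono-≤ (f≤g ∘ suc))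

sum-mono-< : ∀ {k} {f g : Vector ℕ k} → (∀ i → f i ≤ g i) → ∀ i → f i < g i → sum f < sum g
sum-mono-< f≤g zero    f<g = +-mono-<-≤ f<g (sum-mono-≤ (f≤g ∘ suc))
sum-mono-< f≤g (suc i) f<g = +-mono-≤-< (f≤g zero) (sum-mono-< (f≤g ∘ suc) i f<g)

⌊suc≟suc⌋ : ∀ {k} (v a : Fin k) → ⌊ suc v Fin.≟ suc a ⌋ ≡ ⌊ v Fin.≟ a ⌋
⌊suc≟suc⌋ v a with v Fin.≟ a
... | yes _ = refl
... | no _  = refl

∑⟦≟⟧≡1 : ∀ {k} (a : Fin k) → ∑[ v < k ] ⟦ ⌊ v Fin.≟ a ⌋ ⟧ ≡ 1
∑⟦≟⟧≡1 {suc k} zero    = cong suc (sum-replicate-zero k)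
∑⟦≟⟧≡1 {suc k} (suc a) = trans (sum-cong-≗ (λ v → cong ⟦_⟧ (⌊suc≟suc⌋ v a))) (∑⟦≟⟧≡1 a)

module _ {k : ℕ} where

  𝟙 : Subset k → Fin k → ℕ
  𝟙 p e = ⟦ lookup p e ⟧

  lookup-∪ : (p q : Subset k) (e : Fin k) → lookup (p ∪ q) e ≡ lookup p e ∨ lookup q e
  lookup-∪ p q e = lookup-zipWith _∨_ e p q

  lookup-∩ : (p q : Subset k) (e : Fin k) → lookup (p ∩ q) e ≡ lookup p e ∧ lookup q e
  lookup-∩ p q e = lookup-zipWith _∧_ e p q

  lookup-∁ : (p : Subset k) (e : Fin k) → lookup (∁ p) e ≡ not (lookup p e)
  lookup-∁ p e = lookup-map e not p

  ∈⇒lookup : ∀ {p : Subset k} {e} → e ∈ p → lookup p e ≡ true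
  ∈⇒lookup = []=⇒lookup

  lookup⇒∈ : ∀ {p : Subset k} {e} → lookup p e ≡ true → e ∈ p
  lookup⇒∈ = lookup⇒[]= _ _

  ≗-lookup⇒≡ : {p q : Subset k} → (∀ e → lookup p e ≡ lookup q e) → p ≡ q
  ≗-lookup⇒≡ {p} {q} eq = trans (sym (tabulate∘lookup p)) (trans (tabulate-cong eq) (tabulate∘lookup q))

  ∈∪⁺ˡ : ∀ {p q : Subset k} {e} → e ∈ p → e ∈ p ∪ q
  ∈∪⁺ˡ = x∈p∪q⁺ ∘ inj₁

  ∈∪⁺ʳ : ∀ {p q : Subset k} {e} → e ∈ q → e ∈ p ∪ q
  ∈∪⁺ʳ = x∈p∪q⁺ ∘ inj₂

  ∈⇒1≤∣p∣ : ∀ {p : Subset k} {e} → e ∈ p → 1 ≤ ∣ p ∣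
  ∈⇒1≤∣p∣ e∈p = ≤-trans (s≤s z≤n) (x∈p⇒∣p-x∣<∣p∣ e∈p)

  ∈⇒2≤∣p∣ : ∀ {p : Subset k} {e e′} → e ≢ e′ → e ∈ p → e′ ∈ p → 2 ≤ ∣ p ∣
  ∈⇒2≤∣p∣ e≢e′ e∈p e′∈p =
    ≤-trans (s≤s (∈⇒1≤∣p∣ (x∈p∧x≢y⇒x∈p-y e′∈p (e≢e′ ∘ sym)))) (x∈p⇒∣p-x∣<∣p∣ e∈p)

∣p∣≡∑𝟙 : ∀ {k} (p : Subset k) → ∣ p ∣ ≡ sum (𝟙 p)
∣p∣≡∑𝟙 Vec.[]          = refl
∣p∣≡∑𝟙 (true Vec.∷ p)  = cong suc (∣p∣≡∑𝟙 p)
∣p∣≡∑𝟙 (false Vec.∷ p) = ∣p∣≡∑𝟙 p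

-- Formal sums of edge sets, degrees and the handshake lemma

-- Kept syntactic, so that the degree and the size of a formal sum unfold to sums of degrees and sizes.
data FormalSum (k : ℕ) : Set where
  ⟨_⟩ : Subset k → FormalSum k
  _⊕_ : FormalSum k → FormalSum k → FormalSum k

infixl 6 _⊕_

module _ {k : ℕ} where

  multiplicity : FormalSum k → Fin k → ℕ
  multiplicity ⟨ p ⟩   = 𝟙 p
  multiplicity (a ⊕ b) e = multiplicity a e + multiplicity b e

  infix 4 _≈ᶠ_
  record _≈ᶠ_ (a b : FormalSum k) : Set where
    field pointwise : ∀ e → multiplicity a e ≡ multiplicity b e
  open _≈ᶠ_ public

  ∣_∣ᶠ : FormalSum k → ℕ
  ∣ ⟨ p ⟩ ∣ᶠ   = ∣ p ∣
  ∣ a ⊕ b ∣ᶠ = ∣ a ∣ᶠ + ∣ b ∣ᶠ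

  ∣a∣ᶠ≡∑multiplicity : (a : FormalSum k) → ∣ a ∣ᶠ ≡ sum (multiplicity a)
  ∣a∣ᶠ≡∑multiplicity ⟨ p ⟩   = ∣p∣≡∑𝟙 p
  ∣a∣ᶠ≡∑multiplicity (a ⊕ b) =
    trans (cong₂ _+_ (∣a∣ᶠ≡∑multiplicity a) (∣a∣ᶠ≡∑multiplicity b))
          (sym (∑-distrib-+ (multiplicity a) (multiplicity b)))

  ∣∣ᶠ-cong : {a b : FormalSum k} → a ≈ᶠ b → ∣ a ∣ᶠ ≡ ∣ b ∣ᶠ
  ∣∣ᶠ-cong {a} {b} a≈b =
    trans (∣a∣ᶠ≡∑multiplicity a) (trans (sum-cong-≗ (a≈b .pointwise)) (sym (∣a∣ᶠ≡∑multiplicity b)))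

module _ (G : Graph) where

  incidence : Fin (n G) → Fin (m G) → ℕ
  incidence v e = ⟦ incident G v e ⟧

  degᶠ : FormalSum (m G) → Fin (n G) → ℕ
  degᶠ ⟨ X ⟩   v = deg G X v
  degᶠ (a ⊕ b) v = degᶠ a v + degᶠ b v

  deg≡∑ : ∀ X v → deg G X v ≡ ∑[ e < m G ] (𝟙 X e * incidence v e)
  deg≡∑ X v = trans (∣p∣≡∑𝟙 (X ∩ star G v)) (sum-cong-≗ λ e →
    trans (cong ⟦_⟧ (trans (lookup-∩ X (star G v) e)
                           (cong (lookup X e ∧_) (lookup∘tabulate (incident G v) e))))
          (⟦∧⟧ (lookup X e) (incident G v e)))

  degᶠ≡∑ : ∀ a v → degᶠ a v ≡ ∑[ e < m G ] (multiplicity a e * incidence v e)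
  degᶠ≡∑ ⟨ X ⟩   v = deg≡∑ X v
  degᶠ≡∑ (a ⊕ b) v = begin
    degᶠ a v + degᶠ b v
      ≡⟨ cong₂ _+_ (degᶠ≡∑ a v) (degᶠ≡∑ b v) ⟩
    ∑[ e < m G ] (multiplicity a e * incidence v e) + ∑[ e < m G ] (multiplicity b e * incidence v e)
      ≡⟨ ∑-distrib-+ (λ e → multiplicity a e * incidence v e) (λ e → multiplicity b e * incidence v e) ⟨
    ∑[ e < m G ] (multiplicity a e * incidence v e + multiplicity b e * incidence v e)
      ≡⟨ sum-cong-≗ (λ e → *-distribʳ-+ (incidence v e) (multiplicity a e) (multiplicity b e)) ⟨
    ∑[ e < m G ] ((multiplicity a e + multiplicity b e) * incidence v e) ∎
    where open ≡-Reasoning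

  degᶠ-cong : {a b : FormalSum (m G)} → a ≈ᶠ b → ∀ v → degᶠ a v ≡ degᶠ b v
  degᶠ-cong {a} {b} a≈b v = trans (degᶠ≡∑ a v)
    (trans (sum-cong-≗ λ e → cong (_* incidence v e) (a≈b .pointwise e)) (sym (degᶠ≡∑ b v)))

  deg-mono : ∀ {X Y} → X ⊆ Y → ∀ v → deg G X v ≤ deg G Y v
  deg-mono X⊆Y v = p⊆q⇒∣p∣≤∣q∣ λ e∈ →
    let e∈X , e∈star = x∈p∩q⁻ _ _ e∈ in x∈p∩q⁺ (X⊆Y e∈X , e∈star)

  ∑incidence≡2 : ∀ e → ∑[ v < n G ] incidence v e ≡ 2
  ∑incidence≡2 e = begin
    ∑[ v < n G ] incidence v e
      ≡⟨ sum-cong-≗ split ⟩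
    ∑[ v < n G ] (⟦ ⌊ v Fin.≟ a ⌋ ⟧ + ⟦ ⌊ v Fin.≟ b ⌋ ⟧)
      ≡⟨ ∑-distrib-+ (λ v → ⟦ ⌊ v Fin.≟ a ⌋ ⟧) (λ v → ⟦ ⌊ v Fin.≟ b ⌋ ⟧) ⟩
    ∑[ v < n G ] ⟦ ⌊ v Fin.≟ a ⌋ ⟧ + ∑[ v < n G ] ⟦ ⌊ v Fin.≟ b ⌋ ⟧
      ≡⟨ cong₂ _+_ (∑⟦≟⟧≡1 a) (∑⟦≟⟧≡1 b) ⟩
    2 ∎
    where
    open ≡-Reasoning
    a b : Fin (n G)
    a = proj₁ (ends G e)
    b = proj₂ (ends G e)
    split : ∀ v → incidence v e ≡ ⟦ ⌊ v Fin.≟ a ⌋ ⟧ + ⟦ ⌊ v Fin.≟ b ⌋ ⟧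
    split v with v Fin.≟ a | v Fin.≟ b
    ... | yes v≡a  | yes v≡b  = contradiction (trans (sym v≡a) v≡b) (noLoops G e)
    ... | yes _    | no _     = refl
    ... | no _     | yes _    = refl
    ... | no _     | no _     = refl

  handshake : ∀ X → ∑[ v < n G ] deg G X v ≡ 2 * ∣ X ∣
  handshake X = begin
    ∑[ v < n G ] deg G X v
      ≡⟨ sum-cong-≗ (deg≡∑ X) ⟩
    ∑[ v < n G ] ∑[ e < m G ] (𝟙 X e * incidence v e)
      ≡⟨ ∑-comm (λ v e → 𝟙 X e * incidence v e) ⟩
    ∑[ e < m G ] ∑[ v < n G ] (𝟙 X e * incidence v e)
      ≡⟨ sum-cong-≗ (λ e → *-distribˡ-sum (𝟙 X e) (λ v → incidence v e)) ⟨
    ∑[ e < m G ] (𝟙 X e * ∑[ v < n G ] incidence v e)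
      ≡⟨ sum-cong-≗ (λ e → cong (𝟙 X e *_) (∑incidence≡2 e)) ⟩
    ∑[ e < m G ] (𝟙 X e * 2)
      ≡⟨ sum-cong-≗ (λ e → *-comm (𝟙 X e) 2) ⟩
    ∑[ e < m G ] (2 * 𝟙 X e)
      ≡⟨ *-distribˡ-sum 2 (𝟙 X) ⟨
    2 * sum (𝟙 X)
      ≡⟨ cong (2 *_) (∣p∣≡∑𝟙 X) ⟨
    2 * ∣ X ∣ ∎
    where open ≡-Reasoning

  deg≗⇒∣∣≡ : ∀ {X Y} → (∀ v → deg G X v ≡ deg G Y v) → ∣ X ∣ ≡ ∣ Y ∣
  deg≗⇒∣∣≡ {X} {Y} eq = *-cancelˡ-≡ ∣ X ∣ ∣ Y ∣ 2
    (trans (sym (handshake X)) (trans (sum-cong-≗ eq) (handshake Y)))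

  deg≤⇒∣∣< : ∀ {X Y} → (∀ v → deg G X v ≤ deg G Y v) → ∀ v → deg G X v < deg G Y v → ∣ X ∣ < ∣ Y ∣
  deg≤⇒∣∣< {X} {Y} X≤Y v X<Y = *-cancelˡ-< 2 ∣ X ∣ ∣ Y ∣
    (subst₂ _<_ (handshake X) (handshake Y) (sum-mono-< X≤Y v X<Y))

-- Even circuits

toℕ-next : ∀ {k} (i : Fin (suc k)) → toℕ i ≢ k → toℕ (next i) ≡ suc (toℕ i)
toℕ-next {k} i i≢k with k ℕ.≟ toℕ i
... | yes k≡i = contradiction (sym k≡i) i≢k
... | no k≢i  = cong suc (Finₚ.toℕ-lower₁ i k≢i)

next-last : ∀ {k} (i : Fin (suc k)) → toℕ i ≡ k → next i ≡ zero
next-last {k} i i≡k with k ℕ.≟ toℕ i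
... | yes _   = refl
... | no k≢i  = contradiction (sym i≡k) k≢i

next≢id : ∀ {k} → 1 ≤ k → (i : Fin (suc k)) → next i ≢ i
next≢id {k} 1≤k i next≡i with toℕ i ℕ.≟ k
... | yes i≡k = <⇒≢ 1≤k (trans (cong toℕ (trans (sym (next-last i i≡k)) next≡i)) i≡k)
... | no i≢k  = 1+n≢n (trans (sym (toℕ-next i i≢k)) (cong toℕ next≡i))

2∣n+n : ∀ n → 2 ∣ n + n
2∣n+n n = divides n (trans (cong (n +_) (sym (+-identityʳ n))) (*-comm 2 n))

2∣+2 : ∀ {j} → 2 ∣ j → 2 ∣ suc (suc j)
2∣+2 (divides q j≡q*2) = divides (suc q) (cong (λ x → suc (suc x)) j≡q*2)

-- The colour flips at every step around the cycle and is back to c zero after suc k steps.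
alternating⇒even : ∀ {k} (c : Fin (suc k) → Bool) → (∀ i → c (next i) ≡ not (c i)) → 2 ∣ suc k
alternating⇒even {k} c flips with walk k (n<1+n k)
  where
  step : ∀ {j} (1+j<1+k : suc j < suc k) → next (fromℕ< (<-trans (n<1+n j) 1+j<1+k)) ≡ fromℕ< 1+j<1+k
  step {j} 1+j<1+k = Finₚ.toℕ-injective (begin
    toℕ (next (fromℕ< j<1+k)) ≡⟨ toℕ-next _ (<⇒≢ (ℕ.s≤s⁻¹ 1+j<1+k) ∘ trans (sym toℕ-j)) ⟩
    suc (toℕ (fromℕ< j<1+k))  ≡⟨ cong suc toℕ-j ⟩
    suc j                     ≡⟨ Finₚ.toℕ-fromℕ< 1+j<1+k ⟨
    toℕ (fromℕ< 1+j<1+k)      ∎)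
    where
    open ≡-Reasoning
    j<1+k : j < suc k
    j<1+k = <-trans (n<1+n j) 1+j<1+k
    toℕ-j : toℕ (fromℕ< j<1+k) ≡ j
    toℕ-j = Finₚ.toℕ-fromℕ< j<1+k

  flipped : ∀ {j} (1+j<1+k : suc j < suc k) →
            c (fromℕ< 1+j<1+k) ≡ not (c (fromℕ< (<-trans (n<1+n j) 1+j<1+k)))
  flipped 1+j<1+k = trans (cong c (sym (step 1+j<1+k))) (flips _)

  walk : ∀ j (j<1+k : j < suc k) →
         (c (fromℕ< j<1+k) ≡ c zero × 2 ∣ j) ⊎ (c (fromℕ< j<1+k) ≡ not (c zero) × 2 ∣ suc j)
  walk zero    _       = inj₁ (refl , divides 0 refl)
  walk (suc j) 1+j<1+k with walk j (<-trans (n<1+n j) 1+j<1+k)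
  ... | inj₁ (same , 2∣j)    = inj₂ (trans (flipped 1+j<1+k) (cong not same) , 2∣+2 2∣j)
  ... | inj₂ (other , 2∣1+j) = inj₁ (trans (flipped 1+j<1+k) (trans (cong not other) (not-involutive _)) , 2∣1+j)

... | inj₁ (same , _) = contradiction
  (trans (cong c (sym (next-last _ (Finₚ.toℕ-fromℕ< (n<1+n k))))) (trans (flips _) (cong not same)))
  (not-¬ refl)
... | inj₂ (_ , 2∣1+k) = 2∣1+k

module _ (G : Graph) where

  IsMatching : EdgeSet G → Set
  IsMatching X = ∀ v → deg G X v ≤ 1

  incident-ends₁ : ∀ {e u w} → ends G e ≡ (u , w) → incident G u e ≡ true
  incident-ends₁ {u = u} ends≡ rewrite ends≡ with u Fin.≟ u
  ... | yes _   = refl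
  ... | no u≢u  = contradiction refl u≢u

  incident-ends₂ : ∀ {e u w} → ends G e ≡ (u , w) → incident G w e ≡ true
  incident-ends₂ {w = w} ends≡ rewrite ends≡ with w Fin.≟ w
  ... | yes _   = ∨-zeroʳ _
  ... | no w≢w  = contradiction refl w≢w

  joins⇒incident : ∀ {e u w} → Joins G e u w → incident G u e ≡ true × incident G w e ≡ true
  joins⇒incident (inj₁ ends≡) = incident-ends₁ ends≡ , incident-ends₂ ends≡
  joins⇒incident (inj₂ ends≡) = incident-ends₂ ends≡ , incident-ends₁ ends≡

  incident⇒∈star : ∀ v {e} → incident G v e ≡ true → e ∈ star G v
  incident⇒∈star v {e} inc = lookup⇒∈ (trans (lookup∘tabulate (incident G v) e) inc)

  matching-at-most-one : ∀ {X v e e′} → IsMatching X → e ≢ e′ → e ∈ X → e′ ∈ X →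
                         incident G v e ≡ true → incident G v e′ ≡ true → ⊥
  matching-at-most-one {X} {v} {e} {e′} X-matching e≢e′ e∈X e′∈X inc inc′ =
    <⇒≱ (s≤s (s≤s z≤n)) (≤-trans (∈⇒2≤∣p∣ {p = X ∩ star G v} e≢e′ e∈ e′∈) (X-matching v))
    where
    e∈ : e ∈ X ∩ star G v
    e∈ = x∈p∩q⁺ (e∈X , incident⇒∈star v inc)
    e′∈ : e′ ∈ X ∩ star G v
    e′∈ = x∈p∩q⁺ (e′∈X , incident⇒∈star v inc′)

  -- Colour the edges of a circuit by membership in p: two consecutive edges share a vertex, so they
  -- cannot both lie in p, nor both outside p (they would then both lie in q).
  matching-cover⇒even-circuits : ∀ {X} (p q : EdgeSet G) → IsMatching p → IsMatching q → X ⊆ p ∪ q →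
                                 ∀ k → Circuit G X k → 2 ∣ suc k
  matching-cover⇒even-circuits {X} p q p-matching q-matching X⊆p∪q k C =
    alternating⇒even (λ i → lookup p (es i)) alternates
    where
    open Circuit C

    outside-p⇒in-q : ∀ i → lookup p (es i) ≡ false → es i ∈ q
    outside-p⇒in-q i ∉p with x∈p∪q⁻ p q (X⊆p∪q (esIn i))
    ... | inj₁ ∈p = contradiction (trans (sym (∈⇒lookup ∈p)) ∉p) λ ()
    ... | inj₂ ∈q = ∈q

    consecutive-in : ∀ {Y} i → IsMatching Y → es i ∈ Y → es (next i) ∈ Y → ⊥
    consecutive-in {Y} i Y-matching e∈Y e′∈Y =
      matching-at-most-one {Y} {vs (next i)} Y-matching (λ eq → next≢id len≥2 i (sym (esInj eq)))
        e∈Y e′∈Y (proj₂ (joins⇒incident (esJoin i))) (proj₁ (joins⇒incident (esJoin (next i))))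

    alternates : ∀ i → lookup p (es (next i)) ≡ not (lookup p (es i))
    alternates i with lookup p (es i) in e∈p? | lookup p (es (next i)) in e′∈p?
    ... | true  | true  = ⊥-elim (consecutive-in {p} i p-matching (lookup⇒∈ e∈p?) (lookup⇒∈ e′∈p?))
    ... | true  | false = refl
    ... | false | true  = refl
    ... | false | false =
      ⊥-elim (consecutive-in {q} i q-matching (outside-p⇒in-q i e∈p?) (outside-p⇒in-q (next i) e′∈p?))

by-truth-table² : {P : Bool → Bool → Set} →
  P true true → P true false → P false true → P false false → ∀ a b → P a b
by-truth-table² tt tf ft ff true  true  = tt
by-truth-table² tt tf ft ff true  false = tf
by-truth-table² tt tf ft ff false true  = ft
by-truth-table² tt tf ft ff false false = ff

by-truth-table³ : {P : Bool → Bool → Bool → Set} →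
  P true true true → P true true false → P true false true → P true false false →
  P false true true → P false true false → P false false true → P false false false → ∀ a b c → P a b c
by-truth-table³ {P} ttt ttf tft tff _ _ _ _ true  = by-truth-table² {P true} ttt ttf tft tff
by-truth-table³ {P} _ _ _ _ ftt ftf fft fff false = by-truth-table² {P false} ftt ftf fft fff

module _ {k : ℕ} where

  infixr 6 _Δ_
  _Δ_ : Subset k → Subset k → Subset k
  p Δ q = zipWith _xor_ p q

  lookup-Δ : ∀ p q e → lookup (p Δ q) e ≡ lookup p e xor lookup q e
  lookup-Δ p q e = lookup-zipWith _xor_ e p q

  Δ⊆∪ : ∀ p q → p Δ q ⊆ p ∪ q
  Δ⊆∪ p q {e} e∈ = lookup⇒∈ (trans (lookup-∪ p q e)
    (table (lookup p e) (lookup q e) (trans (sym (lookup-Δ p q e)) (∈⇒lookup e∈))))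
    where
    table : ∀ a b → a xor b ≡ true → a ∨ b ≡ true
    table = by-truth-table² (λ ()) (λ _ → refl) (λ _ → refl) (λ ())

  ∉Δ⇒≡ : ∀ p q {e} → lookup (p Δ q) e ≡ false → lookup p e ≡ lookup q e
  ∉Δ⇒≡ p q {e} e∉ = table (lookup p e) (lookup q e) (trans (sym (lookup-Δ p q e)) e∉)
    where
    table : ∀ a b → a xor b ≡ false → a ≡ b
    table = by-truth-table² (λ _ → refl) (λ ()) (λ ()) (λ _ → refl)

  Δ-∩≈ : ∀ p q → ⟨ p ∩ q ⟩ ⊕ ⟨ p ∩ q ⟩ ⊕ ⟨ p Δ q ⟩ ≈ᶠ ⟨ p ⟩ ⊕ ⟨ q ⟩
  Δ-∩≈ p q .pointwise e rewrite lookup-∩ p q e | lookup-Δ p q e = table (lookup p e) (lookup q e)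
    where
    table : ∀ a b → ⟦ a ∧ b ⟧ + ⟦ a ∧ b ⟧ + ⟦ a xor b ⟧ ≡ ⟦ a ⟧ + ⟦ b ⟧
    table = by-truth-table² refl refl refl refl

  disjoint-∪≈⊕ : ∀ {p q : Subset k} → (∀ {e} → e ∈ p → e ∉ q) → ⟨ p ∪ q ⟩ ≈ᶠ ⟨ p ⟩ ⊕ ⟨ q ⟩
  disjoint-∪≈⊕ {p} {q} disjoint .pointwise e rewrite lookup-∪ p q e
    with lookup p e in e∈p? | lookup q e in e∈q?
  ... | true  | true  = contradiction (lookup⇒∈ e∈q?) (disjoint (lookup⇒∈ e∈p?))
  ... | true  | false = refl
  ... | false | _     = refl

-- Three 1-factors

inTwo : Bool → Bool → Bool → Bool
inTwo a b c = (a ∧ b) ∨ (a ∧ c) ∨ (b ∧ c)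

inSome : Bool → Bool → Bool → Bool
inSome a b c = a ∨ b ∨ c

-- 𝓜 and 𝓤 are the paper's, so that core is definitionally coreEdges G M₁ M₂ M₃.
module EdgeClasses {k : ℕ} (M₁ M₂ M₃ : Subset k) where

  covered 𝓜 𝓤 𝓢 𝓣 core : Subset k
  covered = M₁ ∪ M₂ ∪ M₃
  𝓜       = (M₁ ∩ M₂) ∪ (M₁ ∩ M₃) ∪ (M₂ ∩ M₃)
  𝓤       = ∁ covered
  𝓢       = covered ∩ ∁ 𝓜
  𝓣       = M₁ ∩ M₂ ∩ M₃
  core    = 𝓜 ∪ 𝓤

  private
    x y z : Fin k → Bool
    x = lookup M₁
    y = lookup M₂
    z = lookup M₃

  lookup-covered : ∀ e → lookup covered e ≡ inSome (x e) (y e) (z e)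
  lookup-covered e = trans (lookup-∪ M₁ (M₂ ∪ M₃) e) (cong (x e ∨_) (lookup-∪ M₂ M₃ e))

  lookup-𝓜 : ∀ e → lookup 𝓜 e ≡ inTwo (x e) (y e) (z e)
  lookup-𝓜 e = trans (lookup-∪ (M₁ ∩ M₂) ((M₁ ∩ M₃) ∪ (M₂ ∩ M₃)) e) (cong₂ _∨_ (lookup-∩ M₁ M₂ e)
    (trans (lookup-∪ (M₁ ∩ M₃) (M₂ ∩ M₃) e) (cong₂ _∨_ (lookup-∩ M₁ M₃ e) (lookup-∩ M₂ M₃ e))))

  lookup-𝓤 : ∀ e → lookup 𝓤 e ≡ not (inSome (x e) (y e) (z e))
  lookup-𝓤 e = trans (lookup-∁ covered e) (cong not (lookup-covered e))

  lookup-𝓢 : ∀ e → lookup 𝓢 e ≡ inSome (x e) (y e) (z e) ∧ not (inTwo (x e) (y e) (z e))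
  lookup-𝓢 e = trans (lookup-∩ covered (∁ 𝓜) e)
    (cong₂ _∧_ (lookup-covered e) (trans (lookup-∁ 𝓜 e) (cong not (lookup-𝓜 e))))

  lookup-𝓣 : ∀ e → lookup 𝓣 e ≡ x e ∧ y e ∧ z e
  lookup-𝓣 e = trans (lookup-∩ M₁ (M₂ ∩ M₃) e) (cong (x e ∧_) (lookup-∩ M₂ M₃ e))

  lookup-core : ∀ e → lookup core e ≡ inTwo (x e) (y e) (z e) ∨ not (inSome (x e) (y e) (z e))
  lookup-core e = trans (lookup-∪ 𝓜 𝓤 e) (cong₂ _∨_ (lookup-𝓜 e) (lookup-𝓤 e))

  factors≈ : ⟨ M₁ ⟩ ⊕ ⟨ M₂ ⟩ ⊕ ⟨ M₃ ⟩ ≈ᶠ ⟨ 𝓜 ⟩ ⊕ ⟨ 𝓜 ⟩ ⊕ ⟨ 𝓣 ⟩ ⊕ ⟨ 𝓢 ⟩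
  factors≈ .pointwise e rewrite lookup-𝓜 e | lookup-𝓣 e | lookup-𝓢 e = table (x e) (y e) (z e)
    where
    table : ∀ a b c → ⟦ a ⟧ + ⟦ b ⟧ + ⟦ c ⟧ ≡
      ⟦ inTwo a b c ⟧ + ⟦ inTwo a b c ⟧ + ⟦ a ∧ b ∧ c ⟧ + ⟦ inSome a b c ∧ not (inTwo a b c) ⟧
    table = by-truth-table³ refl refl refl refl refl refl refl refl

  ⊤≈ : ⟨ ⊤ ⟩ ≈ᶠ ⟨ 𝓜 ⟩ ⊕ ⟨ 𝓢 ⟩ ⊕ ⟨ 𝓤 ⟩
  ⊤≈ .pointwise e rewrite lookup-replicate e true | lookup-𝓜 e | lookup-𝓢 e | lookup-𝓤 e =
    table (x e) (y e) (z e)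
    where
    table : ∀ a b c → 1 ≡ ⟦ inTwo a b c ⟧ + ⟦ inSome a b c ∧ not (inTwo a b c) ⟧ + ⟦ not (inSome a b c) ⟧
    table = by-truth-table³ refl refl refl refl refl refl refl refl

  Δ-sum≈ : ⟨ M₁ Δ M₂ ⟩ ⊕ ⟨ M₁ Δ M₃ ⟩ ⊕ ⟨ M₂ Δ M₃ ⟩ ⊕ ⟨ 𝓣 ⟩ ⊕ ⟨ 𝓣 ⟩ ≈ᶠ ⟨ 𝓢 ⟩ ⊕ ⟨ 𝓜 ⟩ ⊕ ⟨ 𝓢 ⟩ ⊕ ⟨ 𝓜 ⟩
  Δ-sum≈ .pointwise e
    rewrite lookup-Δ M₁ M₂ e | lookup-Δ M₁ M₃ e | lookup-Δ M₂ M₃ e | lookup-𝓣 e | lookup-𝓢 e | lookup-𝓜 e =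
    table (x e) (y e) (z e)
    where
    table : ∀ a b c → ⟦ a xor b ⟧ + ⟦ a xor c ⟧ + ⟦ b xor c ⟧ + ⟦ a ∧ b ∧ c ⟧ + ⟦ a ∧ b ∧ c ⟧ ≡
      ⟦ inSome a b c ∧ not (inTwo a b c) ⟧ + ⟦ inTwo a b c ⟧
        + ⟦ inSome a b c ∧ not (inTwo a b c) ⟧ + ⟦ inTwo a b c ⟧
    table = by-truth-table³ refl refl refl refl refl refl refl refl

  𝓜⊆covered : 𝓜 ⊆ covered
  𝓜⊆covered {e} e∈ = lookup⇒∈ (trans (lookup-covered e)
    (table (x e) (y e) (z e) (trans (sym (lookup-𝓜 e)) (∈⇒lookup e∈))))
    where
    table : ∀ a b c → inTwo a b c ≡ true → inSome a b c ≡ true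
    table = by-truth-table³ (λ _ → refl) (λ _ → refl) (λ _ → refl) (λ ())
                            (λ _ → refl) (λ ()) (λ ()) (λ ())

  covered⊆𝓢∪𝓜 : covered ⊆ 𝓢 ∪ 𝓜
  covered⊆𝓢∪𝓜 {e} e∈ with e ∈? 𝓜
  ... | yes e∈𝓜 = ∈∪⁺ʳ e∈𝓜
  ... | no  e∉𝓜 = ∈∪⁺ˡ (x∈p∩q⁺ (e∈ , x∉p⇒x∈∁p e∉𝓜))

  𝓢∪𝓜≈ : ⟨ 𝓢 ∪ 𝓜 ⟩ ≈ᶠ ⟨ 𝓢 ⟩ ⊕ ⟨ 𝓜 ⟩
  𝓢∪𝓜≈ = disjoint-∪≈⊕ λ e∈𝓢 → x∈∁p⇒x∉p (proj₂ (x∈p∩q⁻ covered (∁ 𝓜) e∈𝓢))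

  core≈ : ⟨ core ⟩ ≈ᶠ ⟨ 𝓜 ⟩ ⊕ ⟨ 𝓤 ⟩
  core≈ = disjoint-∪≈⊕ (x∈p⇒x∉∁p ∘ 𝓜⊆covered)

  differing⇒covered : ∀ {e} → lookup M₁ e ≢ lookup M₂ e → e ∈ covered
  differing⇒covered {e} x≢y with lookup M₁ e in e∈M₁?
  ... | true  = ∈∪⁺ˡ (lookup⇒∈ e∈M₁?)
  ... | false = ∈∪⁺ʳ (∈∪⁺ˡ (lookup⇒∈ (¬-not (x≢y ∘ sym))))

  uniform⇒core : ∀ {e} → lookup M₁ e ≡ lookup M₂ e → lookup M₂ e ≡ lookup M₃ e → e ∈ core
  uniform⇒core {e} x≡y y≡z = lookup⇒∈ (trans (lookup-core e) (table (x e) (y e) (z e) x≡y y≡z))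
    where
    table : ∀ a b c → a ≡ b → b ≡ c → inTwo a b c ∨ not (inSome a b c) ≡ true
    table true  _ _ refl refl = refl
    table false _ _ refl refl = refl

  Δ-pair-cover : ∀ {A B} → (∀ {e} → lookup A e ≡ false → lookup B e ≡ false → e ∈ core) →
                 ∀ e → e ∈ A ∪ B ∪ core
  Δ-pair-cover {A} {B} outside⇒core e with lookup A e in e∈A? | lookup B e in e∈B?
  ... | true  | _     = ∈∪⁺ˡ (lookup⇒∈ e∈A?)
  ... | false | true  = ∈∪⁺ʳ (∈∪⁺ˡ (lookup⇒∈ e∈B?))
  ... | false | false = ∈∪⁺ʳ (∈∪⁺ʳ (outside⇒core e∈A? e∈B?))

  cover₁₂,₁₃ : ∀ e → e ∈ (M₁ Δ M₂) ∪ (M₁ Δ M₃) ∪ core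
  cover₁₂,₁₃ = Δ-pair-cover λ e∉₁₂ e∉₁₃ →
    uniform⇒core (∉Δ⇒≡ M₁ M₂ e∉₁₂) (trans (sym (∉Δ⇒≡ M₁ M₂ e∉₁₂)) (∉Δ⇒≡ M₁ M₃ e∉₁₃))

  cover₁₂,₂₃ : ∀ e → e ∈ (M₁ Δ M₂) ∪ (M₂ Δ M₃) ∪ core
  cover₁₂,₂₃ = Δ-pair-cover λ e∉₁₂ e∉₂₃ → uniform⇒core (∉Δ⇒≡ M₁ M₂ e∉₁₂) (∉Δ⇒≡ M₂ M₃ e∉₂₃)

  cover₁₃,₂₃ : ∀ e → e ∈ (M₁ Δ M₃) ∪ (M₂ Δ M₃) ∪ core
  cover₁₃,₂₃ = Δ-pair-cover λ e∉₁₃ e∉₂₃ →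
    uniform⇒core (trans (∉Δ⇒≡ M₁ M₃ e∉₁₃) (sym (∉Δ⇒≡ M₂ M₃ e∉₂₃))) (∉Δ⇒≡ M₂ M₃ e∉₂₃)

-- Local structure and counting

-- The possible degrees (in 𝓢, 𝓜, 𝓤) at a vertex.
data Profile : ℕ → ℕ → ℕ → Set where
  singles  : Profile 3 0 0
  balanced : Profile 1 1 1

w+w≤3⇒w≤1 : ∀ {w} → w + w ≤ 3 → w ≤ 1
w+w≤3⇒w≤1 {w} w+w≤3 with w ℕ.≤? 1
... | yes w≤1 = w≤1
... | no  w≰1 = contradiction (≤-trans (+-mono-≤ (≰⇒> w≰1) (≰⇒> w≰1)) w+w≤3) (<⇒≱ (n<1+n 3))

vertex-profile : ∀ {w t s u} → t ≤ 1 → w + w + t + s ≡ 3 → w + s + u ≡ 3 → 2 ∣ w + u → Profile s w u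
vertex-profile {w} {t} {s} t≤1 eq₁ = classify t≤1 (w+w≤3⇒w≤1 w+w≤3) eq₁
  where
  w+w≤3 : w + w ≤ 3
  w+w≤3 = ≤-trans (≤-trans (m≤m+n (w + w) t) (m≤m+n (w + w + t) s)) (≤-reflexive eq₁)

  classify : ∀ {w t s u} → t ≤ 1 → w ≤ 1 → w + w + t + s ≡ 3 → w + s + u ≡ 3 → 2 ∣ w + u → Profile s w u
  classify z≤n       z≤n       refl refl _   = singles
  classify z≤n       (s≤s z≤n) refl refl _   = balanced
  classify (s≤s z≤n) z≤n       refl refl 2∣1 = contradiction (∣1⇒≡1 2∣1) λ ()
  classify (s≤s z≤n) (s≤s z≤n) refl refl 2∣3 = contradiction (∣1⇒≡1 (∣m+n∣m⇒∣n 2∣3 ∣-refl)) λ ()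

module _ {s w u : ℕ} where

  Profile⇒w≡u : Profile s w u → w ≡ u
  Profile⇒w≡u singles  = refl
  Profile⇒w≡u balanced = refl

  Profile⇒w≤1 : Profile s w u → w ≤ 1
  Profile⇒w≤1 singles  = z≤n
  Profile⇒w≤1 balanced = ≤-refl

  Profile⇒u≤1 : Profile s w u → u ≤ 1
  Profile⇒u≤1 singles  = z≤n
  Profile⇒u≤1 balanced = ≤-refl

  Profile⇒w≤s : Profile s w u → w ≤ s
  Profile⇒w≤s singles  = z≤n
  Profile⇒w≤s balanced = ≤-refl

  Profile⇒w<s : Profile s w u → s ≢ 1 → w < s
  Profile⇒w<s singles  _   = s≤s z≤n
  Profile⇒w<s balanced s≢1 = contradiction refl s≢1

Profile⇒w≡1 : ∀ {w u} → Profile 1 w u → w ≡ 1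
Profile⇒w≡1 balanced = refl

one-below-average : ∀ x y z {n} → x + y + z < 3 * n → x < n ⊎ y < n ⊎ z < n
one-below-average x y z {n} sum<3n with x <? n | y <? n | z <? n
... | yes x<n | _       | _       = inj₁ x<n
... | no _    | yes y<n | _       = inj₂ (inj₁ y<n)
... | no _    | no _    | yes z<n = inj₂ (inj₂ z<n)
... | no x≮n  | no y≮n  | no z≮n  = contradiction sum<3n (≤⇒≯ (begin
  3 * n     ≡⟨ solve (n ∷ []) ⟩
  n + n + n ≤⟨ +-mono-≤ (+-mono-≤ (≮⇒≥ x≮n) (≮⇒≥ y≮n)) (≮⇒≥ z≮n) ⟩
  x + y + z ∎))
  where open ≤-Reasoning

balanced-bound : ∀ s w {k d z ℓ} → k ≡ w + w → d ≡ s + w → z ≡ 0 → ℓ ≡ w + s + w → 1 ≤ s + w →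
                 9 * (k + d + z) < 14 * ℓ
balanced-bound s w refl refl refl refl 1≤s+w = begin-strict
  9 * (w + w + (s + w) + 0)               <⟨ m<m+n _ (≤-trans 1≤s+w (+-monoˡ-≤ w (m≤n*m s 5))) ⟩
  9 * (w + w + (s + w) + 0) + (5 * s + w) ≡⟨ solve (s ∷ w ∷ []) ⟩
  14 * (w + s + w)                        ∎
  where open ≤-Reasoning

averaged-bound : ∀ a b c t s w {k ℓ} → a + b + c + t + t ≡ s + w + s + w →
                 k ≡ w + w → ℓ ≡ w + s + w → w < s →
                 9 * (a + b + k) + 9 * (a + c + k) + 9 * (b + c + k) < 3 * (14 * ℓ)
averaged-bound a b c t s w Δ-sum refl refl w<s = begin-strict
  9 * (a + b + (w + w)) + 9 * (a + c + (w + w)) + 9 * (b + c + (w + w)) ≡⟨ solve (a ∷ b ∷ c ∷ w ∷ []) ⟩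
  18 * (a + b + c) + 54 * w          ≤⟨ +-monoˡ-≤ (54 * w) (*-monoʳ-≤ 18 (m≤m+n (a + b + c) (t + t))) ⟩
  18 * (a + b + c + (t + t)) + 54 * w ≡⟨ cong (λ d → 18 * d + 54 * w) (trans (sym (+-assoc _ t t)) Δ-sum) ⟩
  18 * (s + w + s + w) + 54 * w       ≡⟨ solve (s ∷ w ∷ []) ⟩
  36 * s + 84 * w + 6 * w             <⟨ +-monoʳ-< (36 * s + 84 * w) (*-monoʳ-< 6 w<s) ⟩
  36 * s + 84 * w + 6 * s             ≡⟨ solve (s ∷ w ∷ []) ⟩
  3 * (14 * (w + s + w))              ∎
  where open ≤-Reasoning

module _ (G : Graph) where

  one-factor⇒matching : ∀ {X} → IsOneFactor G X → IsMatching G X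
  one-factor⇒matching X-factor = ≤-reflexive ∘ X-factor

  Δ-even : ∀ {p q} → IsOneFactor G p → IsOneFactor G q → IsEvenCycle G (p Δ q)
  Δ-even {p} {q} p-factor q-factor = cycle , matching-cover⇒even-circuits G p q p-matching q-matching (Δ⊆∪ p q)
    where
    p-matching : IsMatching G p
    p-matching = one-factor⇒matching {p} p-factor
    q-matching : IsMatching G q
    q-matching = one-factor⇒matching {q} q-factor

    cycle : IsCycle G (p Δ q)
    cycle v = ∣m+n∣m⇒∣n (subst (2 ∣_) (sym degrees) ∣-refl) (2∣n+n (deg G (p ∩ q) v))
      where
      degrees : deg G (p ∩ q) v + deg G (p ∩ q) v + deg G (p Δ q) v ≡ 2
      degrees = trans (degᶠ-cong G (Δ-∩≈ p q) v) (cong₂ _+_ (p-factor v) (q-factor v))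

  ∅-even : IsEvenCycle G ∅
  ∅-even = (λ v → subst (2 ∣_) (sym (deg≡0 v)) (2 ∣0)) , λ k C → contradiction (Circuit.esIn C zero) ∉⊥
    where
    deg≡0 : ∀ v → deg G ∅ v ≡ 0
    deg≡0 v = trans (cong ∣_∣ (∩-zeroˡ (star G v))) (∣⊥∣≡0 (m G))

module ThreeOneFactors (G : Graph) (cubic : Cubic G) {M₁ M₂ M₃ : EdgeSet G}
  (M₁-factor : IsOneFactor G M₁) (M₂-factor : IsOneFactor G M₂) (M₃-factor : IsOneFactor G M₃)
  (M₁≢M₂ : M₁ ≢ M₂) (core-cycle : IsCycle G (coreEdges G M₁ M₂ M₃)) where

  open EdgeClasses M₁ M₂ M₃ public

  profile : ∀ v → Profile (deg G 𝓢 v) (deg G 𝓜 v) (deg G 𝓤 v)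
  profile v = vertex-profile 𝓣≤1
    (trans (sym (degᶠ-cong G factors≈ v)) factor-degrees)
    (trans (sym (degᶠ-cong G ⊤≈ v)) (cubic v))
    (subst (2 ∣_) (degᶠ-cong G core≈ v) (core-cycle v))
    where
    𝓣≤1 : deg G 𝓣 v ≤ 1
    𝓣≤1 = ≤-trans (deg-mono G (p∩q⊆p M₁ (M₂ ∩ M₃)) v) (≤-reflexive (M₁-factor v))
    factor-degrees : deg G M₁ v + deg G M₂ v + deg G M₃ v ≡ 3
    factor-degrees = cong₂ _+_ (cong₂ _+_ (M₁-factor v) (M₂-factor v)) (M₃-factor v)

  𝓜-matching : IsMatching G 𝓜
  𝓜-matching = Profile⇒w≤1 ∘ profile

  𝓤-matching : IsMatching G 𝓤
  𝓤-matching = Profile⇒u≤1 ∘ profile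

  core-even : IsEvenCycle G core
  core-even = core-cycle , matching-cover⇒even-circuits G 𝓜 𝓤 𝓜-matching 𝓤-matching id

  Δ₁₂-even : IsEvenCycle G (M₁ Δ M₂)
  Δ₁₂-even = Δ-even G M₁-factor M₂-factor

  Δ₁₃-even : IsEvenCycle G (M₁ Δ M₃)
  Δ₁₃-even = Δ-even G M₁-factor M₃-factor

  Δ₂₃-even : IsEvenCycle G (M₂ Δ M₃)
  Δ₂₃-even = Δ-even G M₂-factor M₃-factor

  ∣𝓤∣≡∣𝓜∣ : ∣ 𝓤 ∣ ≡ ∣ 𝓜 ∣
  ∣𝓤∣≡∣𝓜∣ = deg≗⇒∣∣≡ G {𝓤} {𝓜} (λ v → sym (Profile⇒w≡u (profile v)))

  ∣core∣≡ : ∣ core ∣ ≡ ∣ 𝓜 ∣ + ∣ 𝓜 ∣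
  ∣core∣≡ = trans (∣∣ᶠ-cong core≈) (cong (∣ 𝓜 ∣ +_) ∣𝓤∣≡∣𝓜∣)

  ∣E∣≡ : m G ≡ ∣ 𝓜 ∣ + ∣ 𝓢 ∣ + ∣ 𝓜 ∣
  ∣E∣≡ = trans (sym (∣⊤∣≡n (m G))) (trans (∣∣ᶠ-cong ⊤≈) (cong (∣ 𝓜 ∣ + ∣ 𝓢 ∣ +_) ∣𝓤∣≡∣𝓜∣))

  ∣𝓢∪𝓜∣≡ : ∣ 𝓢 ∪ 𝓜 ∣ ≡ ∣ 𝓢 ∣ + ∣ 𝓜 ∣
  ∣𝓢∪𝓜∣≡ = ∣∣ᶠ-cong 𝓢∪𝓜≈

  ∣Δ∣-sum : ∣ M₁ Δ M₂ ∣ + ∣ M₁ Δ M₃ ∣ + ∣ M₂ Δ M₃ ∣ + ∣ 𝓣 ∣ + ∣ 𝓣 ∣ ≡ ∣ 𝓢 ∣ + ∣ 𝓜 ∣ + ∣ 𝓢 ∣ + ∣ 𝓜 ∣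
  ∣Δ∣-sum = ∣∣ᶠ-cong Δ-sum≈

  𝓢∪𝓜-nonempty : 1 ≤ ∣ 𝓢 ∣ + ∣ 𝓜 ∣
  𝓢∪𝓜-nonempty with Finₚ.¬∀⟶∃¬ (m G) _ (λ e → lookup M₁ e Boolₚ.≟ lookup M₂ e) (M₁≢M₂ ∘ ≗-lookup⇒≡)
  ... | e , x≢y = ≤-trans (∈⇒1≤∣p∣ (covered⊆𝓢∪𝓜 (differing⇒covered x≢y))) (≤-reflexive ∣𝓢∪𝓜∣≡)

  balanced-cover : (∀ v → deg G 𝓢 v ≡ 1) → HasShortEven3CC G
  balanced-cover 𝓢-perfect = core , 𝓢 ∪ 𝓜 , ∅ , core-even , 𝓢∪𝓜-even , ∅-even G , covers , short
    where
    𝓜-perfect : ∀ v → deg G 𝓜 v ≡ 1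
    𝓜-perfect v = Profile⇒w≡1 (subst (λ s → Profile s (deg G 𝓜 v) (deg G 𝓤 v)) (𝓢-perfect v) (profile v))

    𝓢∪𝓜-even : IsEvenCycle G (𝓢 ∪ 𝓜)
    𝓢∪𝓜-even = (λ v → subst (2 ∣_) (sym (deg≡2 v)) ∣-refl)
             , matching-cover⇒even-circuits G 𝓢 𝓜 (≤-reflexive ∘ 𝓢-perfect) (≤-reflexive ∘ 𝓜-perfect) id
      where
      deg≡2 : ∀ v → deg G (𝓢 ∪ 𝓜) v ≡ 2
      deg≡2 v = trans (degᶠ-cong G 𝓢∪𝓜≈ v) (cong₂ _+_ (𝓢-perfect v) (𝓜-perfect v))

    covers : ∀ e → e ∈ core ∪ (𝓢 ∪ 𝓜) ∪ ∅
    covers e with e ∈? covered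
    ... | yes e∈ = ∈∪⁺ʳ (∈∪⁺ˡ (covered⊆𝓢∪𝓜 e∈))
    ... | no  e∉ = ∈∪⁺ˡ (∈∪⁺ʳ (x∉p⇒x∈∁p e∉))

    short : 9 * (∣ core ∣ + ∣ 𝓢 ∪ 𝓜 ∣ + ∣ ∅ {m G} ∣) < 14 * m G
    short = balanced-bound (∣ 𝓢 ∣) (∣ 𝓜 ∣) ∣core∣≡ ∣𝓢∪𝓜∣≡ (∣⊥∣≡0 (m G)) ∣E∣≡ 𝓢∪𝓜-nonempty

  three-covers-average : ∣ 𝓜 ∣ < ∣ 𝓢 ∣ →
    9 * (∣ M₁ Δ M₂ ∣ + ∣ M₁ Δ M₃ ∣ + ∣ core ∣) + 9 * (∣ M₁ Δ M₂ ∣ + ∣ M₂ Δ M₃ ∣ + ∣ core ∣)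
      + 9 * (∣ M₁ Δ M₃ ∣ + ∣ M₂ Δ M₃ ∣ + ∣ core ∣) < 3 * (14 * m G)
  three-covers-average =
    averaged-bound (∣ M₁ Δ M₂ ∣) (∣ M₁ Δ M₃ ∣) (∣ M₂ Δ M₃ ∣) (∣ 𝓣 ∣) (∣ 𝓢 ∣) (∣ 𝓜 ∣) ∣Δ∣-sum ∣core∣≡ ∣E∣≡

  unbalanced-cover : ∃ (λ v → deg G 𝓢 v ≢ 1) → HasShortEven3CC G
  unbalanced-cover (v , 𝓢≢1) with one-below-average _ _ _ (three-covers-average 𝓜<𝓢)
    where
    𝓜<𝓢 : ∣ 𝓜 ∣ < ∣ 𝓢 ∣
    𝓜<𝓢 = deg≤⇒∣∣< G {𝓜} {𝓢} (Profile⇒w≤s ∘ profile) v (Profile⇒w<s (profile v) 𝓢≢1)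
  ... | inj₁ short        = M₁ Δ M₂ , M₁ Δ M₃ , core , Δ₁₂-even , Δ₁₃-even , core-even , cover₁₂,₁₃ , short
  ... | inj₂ (inj₁ short) = M₁ Δ M₂ , M₂ Δ M₃ , core , Δ₁₂-even , Δ₂₃-even , core-even , cover₁₂,₂₃ , short
  ... | inj₂ (inj₂ short) = M₁ Δ M₃ , M₂ Δ M₃ , core , Δ₁₃-even , Δ₂₃-even , core-even , cover₁₃,₂₃ , short

  short-even-3-cycle-cover : HasShortEven3CC G
  short-even-3-cycle-cover with Finₚ.all? (λ v → deg G 𝓢 v ℕ.≟ 1)
  ... | yes 𝓢-perfect  = balanced-cover 𝓢-perfect
  ... | no ¬𝓢-perfect = unbalanced-cover (Finₚ.¬∀⟶∃¬ _ _ (λ v → deg G 𝓢 v ℕ.≟ 1) ¬𝓢-perfect)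

mainTheorem14 : (G : Graph) → Cubic G → HasCyclicCore G → HasShortEven3CC G
mainTheorem14 G cubic (_ , _ , _ , M₁-factor , M₂-factor , M₃-factor , M₁≢M₂ , _ , _ , core-cycle) =
  ThreeOneFactors.short-even-3-cycle-cover G cubic M₁-factor M₂-factor M₃-factor M₁≢M₂ core-cycle
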